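{- Let $p$ be a prime and $u,v \in \mathbb{N}$ with $u \mid v$, so that $GF(p^u) \subseteq GF(p^v)$. Let $m=p^u-1$, $n=p^v-1$ and $l=n/m$. Let $\phi: GF(p^v)^* \to \mathbb{Z}_n$ be a group isomorphism from the multiplicative group $GF(p^v)^*$ to the additive group $\mathbb{Z}_n=\mathbb{Z}/n\mathbb{Z}$. Suppose $m>1$ and $m \mid l$. If the positive divisors of $m$ are $d_1,\dots,d_r$, then $$A=\phi^{ -1}\left(\left\{\frac{d_1 l}{m}, \frac{d_2 l}{m}, \dots, \frac{d_r l}{m}\right\}\right)$$ is linearly independent over $GF(p^u)$.
   Context: $GF(q)$ denotes the finite field with $q$ elements. -}

module Defs where

open import Level using (0ℓ)
open import Data.Nat using (ℕ; zero; suc; _∸_; _^_)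
import Data.Nat as N
open import Data.Nat.DivMod using (_mod_)
import Data.Nat.DivMod as D
open import Data.Nat.Divisibility using (_∣?_)
open import Data.Fin using (Fin; toℕ)
open import Data.List using (List; []; _∷_; filter; upTo; map; length)
open import Data.List.Relation.Unary.All using (All)
open import Data.Vec using (Vec; []; _∷_)
open import Data.Product using (Σ; _×_; _,_; proj₁)
open import Relation.Binary.PropositionalEquality using (_≡_; _≢_)
open import Algebra.Structures using (IsCommutativeRing)
open import Function.Bundles using (_↔_)

record FiniteField (q : ℕ) : Set₁ where
  infixl 6 _+_
  infixl 7 _*_
  field
    Carrier : Set
    _+_ _*_ : Carrier → Carrier → Carrier
    -_ : Carrier → Carrier
    0# 1# : Carrier
    isCommutativeRing : IsCommutativeRing _≡_ _+_ _*_ -_ 0# 1#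
    0≢1 : 0# ≢ 1#
    inverse : ∀ x → x ≢ 0# → Σ Carrier (λ y → x * y ≡ 1#)
    card : Fin q ↔ Carrier

  Units : Set
  Units = Σ Carrier (λ x → x ≢ 0#)

open FiniteField

-- A field embedding K ↪ F (a unital ring homomorphism; automatically injective).
-- This realizes K = GF(p^u) as the subfield GF(p^u) ⊆ GF(p^v) = F.
record Embedding {q r : ℕ} (K : FiniteField q) (F : FiniteField r) : Set where
  field
    ι : Carrier K → Carrier F
    ι-+ : ∀ a b → ι (_+_ K a b) ≡ _+_ F (ι a) (ι b)
    ι-* : ∀ a b → ι (_*_ K a b) ≡ _*_ F (ι a) (ι b)
    ι-0 : ι (0# K) ≡ 0# F
    ι-1 : ι (1# K) ≡ 1# F

addMod : ∀ {n} → Fin n → Fin n → Fin n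
addMod {suc k} a b = (toℕ a N.+ toℕ b) mod suc k

record GroupIso {q : ℕ} (F : FiniteField q) (n : ℕ) : Set where
  field
    φ : Units F → Fin n
    φ-cong : ∀ (x y : Units F) → proj₁ x ≡ proj₁ y → φ x ≡ φ y
    φ-hom : ∀ (x y : Units F) (h : _*_ F (proj₁ x) (proj₁ y) ≢ 0# F) →
            φ (_*_ F (proj₁ x) (proj₁ y) , h) ≡ addMod (φ x) (φ y)
    φ-injective : ∀ (x y : Units F) → φ x ≡ φ y → proj₁ x ≡ proj₁ y
    φ-surjective : ∀ (k : Fin n) → Σ (Units F) (λ x → φ x ≡ k)

-- Natural-number division, total (division by 0 gives 0; only used with nonzero divisor).
div : ℕ → ℕ → ℕ
div a zero = 0
div a (suc k) = D._/_ a (suc k)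

divisors : ℕ → List ℕ
divisors m = filter (λ d → d ∣? m) (map suc (upTo m))

linComb : ∀ {q r} {K : FiniteField q} {F : FiniteField r} → Embedding K F →
          (xs : List (Carrier F)) → Vec (Carrier K) (length xs) → Carrier F
linComb {F = F} e [] [] = 0# F
linComb {F = F} e (x ∷ xs) (c ∷ cs) = _+_ F (_*_ F (Embedding.ι e c) x) (linComb e xs cs)

LinearlyIndependent : ∀ {q r} {K : FiniteField q} {F : FiniteField r} → Embedding K F →
                      List (Carrier F) → Set
LinearlyIndependent {K = K} {F = F} e xs =
  ∀ (cs : Vec (Carrier K) (length xs)) → linComb e xs cs ≡ 0# F →
  Data.Vec.Relation.Unary.All.All (λ c → c ≡ 0# K) cs
  where import Data.Vec.Relation.Unary.All

module Submission where

-- Write Q = p^u = m + 1 and n = p^v - 1 = m²t, and let β be the unit with φ(β) = t. Then the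
-- element of φ-value d·l/m = d·t is β^d, and γ = β^m has multiplicative order exactly m.
-- The Frobenius map σ(z) = z^Q is a ring endomorphism of F fixing K, and σ(β^d) = β^(dQ) = γ^d·β^d:
-- the β^d are eigenvectors of σ whose eigenvalues γ^d are pairwise distinct for 1 ≤ d ≤ m and
-- are themselves fixed by σ. Eigenvectors with distinct σ-fixed eigenvalues are linearly
-- independent over the σ-fixed elements: subtracting σ of a relation Σ cᵢxᵢ = 0 from μ₁ times it
-- leaves Σ (μ₁ - μᵢ)cᵢxᵢ = 0, a relation among x₂, x₃, … with σ-fixed coefficients, so induction
-- kills c₂, c₃, … and then c₁.

open import Defs
open import Level using (0ℓ)
open import Algebra.Bundles using (CommutativeMonoid; CommutativeSemiring; CommutativeRing)
import Algebra.Properties.CommutativeMonoid.Sum as Sum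
open import Data.Empty using (⊥-elim)
open import Data.Fin as Fin using (Fin; toℕ; inject₁; fromℕ)
open import Data.Fin.Properties as Finₚ using (punchInᵢ≢i)
open import Data.List using (List; []; _∷_; map; length; filter; upTo)
open import Data.List.Membership.Propositional using (_∈_)
open import Data.List.Membership.Propositional.Properties using (∈-filter⁻; ∈-map⁻; ∈-upTo⁻)
open import Data.List.Properties using (map-cong-local)
open import Data.List.Relation.Unary.All as All using (All; []; _∷_)
open import Data.List.Relation.Unary.AllPairs using (AllPairs; _∷_)
import Data.List.Relation.Unary.AllPairs.Properties as AllPairsₚ
open import Data.Nat as ℕ using (ℕ; zero; suc; _∸_; _<_; _≤_; z<s; s<s; NonZero)
import Data.Nat.Properties as ℕₚ
open import Data.Nat.DivMod using (_%_; _/_; m<n⇒m%n≡m; m*n%n≡0; n%n≡0)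
open import Data.Nat.Divisibility using (_∣_; divides; _∣?_)
open import Data.Nat.Primality using (Prime; prime⇒nonZero)
open import Data.Product using (Σ; _,_; proj₁; proj₂)
open import Data.Sum using (_⊎_; inj₁; inj₂; [_,_])
open import Data.Vec using (Vec; []; _∷_)
import Data.Vec as Vec
import Data.Vec.Relation.Unary.All as VecAll
import Data.Vec.Relation.Unary.All.Properties as VecAllₚ
open import Data.Vec.Functional using (removeAt)
open import Function using (_∘_; id; Inverse; _↔_; mk↔ₛ′)
open import Function.Properties.Inverse using (↔-sym; ↔-trans; ↔⇒↣)
open import Relation.Binary.Definitions using (DecidableEquality)
open import Relation.Binary.PropositionalEquality
  using (_≡_; _≢_; refl; sym; trans; cong; cong₂; subst; module ≡-Reasoning)
open import Relation.Nullary using (yes; no)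
open import Relation.Nullary.Decidable using (via-injection)
open import Relation.Unary using (Pred; Decidable)

module Arithmetic where

  open import Data.Nat using (_+_; _*_; _^_; _!; nonTrivial⇒≢1)
  open import Data.Nat.Combinatorics using (_C_; nCk≡n!/k![n-k]!; k![n∸k]!∣n!)
  open import Data.Nat.DivMod using (m/n*n≡m; m*n/n≡m; %-distribˡ-+; m%n%n≡m%n)
  open import Data.Nat.Divisibility using (_∤_; ∣1⇒≡1; ∣⇒≤; m∣m*n; _∣0; ∣m∣n⇒∣m+n)
  open import Data.Nat.Primality using (euclidsLemma; prime⇒nonTrivial)
  open ≡-Reasoning

  prime∤! : ∀ {p} → Prime p → ∀ {j} → j < p → p ∤ j !
  prime∤! p-prime {zero}  _   p∣1  = nonTrivial⇒≢1 {{prime⇒nonTrivial p-prime}} (∣1⇒≡1 p∣1)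
  prime∤! p-prime {suc j} j<p p∣j! with euclidsLemma (suc j) (j !) p-prime p∣j!
  ... | inj₁ p∣1+j = ℕₚ.<⇒≱ j<p (∣⇒≤ p∣1+j)
  ... | inj₂ p∣j!  = prime∤! p-prime (ℕₚ.<-trans (ℕₚ.n<1+n j) j<p) p∣j!

  n∣n! : ∀ n .{{_ : NonZero n}} → n ∣ n !
  n∣n! (suc n) = m∣m*n (n !)

  nCk*[k!*[n∸k]!]≡n! : ∀ {n k} → k ≤ n → (n C k) * (k ! * (n ∸ k) !) ≡ n !
  nCk*[k!*[n∸k]!]≡n! {n} {k} k≤n =
    trans (cong (_* (k ! * (n ∸ k) !)) (nCk≡n!/k![n-k]! k≤n)) (m/n*n≡m (k![n∸k]!∣n! k≤n))
    where
    instance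
      k!*[n∸k]!≢0 : NonZero (k ! * (n ∸ k) !)
      k!*[n∸k]!≢0 = ℕₚ._!*_!≢0 k (n ∸ k)

  prime∣C : ∀ {p} → Prime p → ∀ {k} → 0 < k → k < p → p ∣ p C k
  prime∣C {p} p-prime {k} 0<k k<p
    with euclidsLemma (p C k) (k ! * (p ∸ k) !) p-prime
           (subst (p ∣_) (sym (nCk*[k!*[n∸k]!]≡n! (ℕₚ.<⇒≤ k<p))) (n∣n! p {{prime⇒nonZero p-prime}}))
  ... | inj₁ p∣C = p∣C
  ... | inj₂ p∣k!*[p∸k]! =
    ⊥-elim ([ prime∤! p-prime k<p , prime∤! p-prime (ℕₚ.∸-monoʳ-< {p} {k} {0} 0<k (ℕₚ.<⇒≤ k<p)) ]
              (euclidsLemma (k !) ((p ∸ k) !) p-prime p∣k!*[p∸k]!))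

  m∣[1+m]^k∸1 : ∀ m k → m ∣ suc m ^ k ∸ 1
  m∣[1+m]^k∸1 m zero    = m ∣0
  m∣[1+m]^k∸1 m (suc k) =
    subst (m ∣_) (sym [1+m]^[1+k]∸1) (∣m∣n⇒∣m+n (m∣[1+m]^k∸1 m k) (m∣m*n (suc m ^ k)))
    where
    [1+m]^[1+k]∸1 : suc m ^ suc k ∸ 1 ≡ (suc m ^ k ∸ 1) + m * suc m ^ k
    [1+m]^[1+k]∸1 = ℕₚ.+-∸-comm (m * suc m ^ k) (ℕₚ.m^n>0 (suc m) k)

  [p^u∸1]∣[p^v∸1] : ∀ p .{{_ : NonZero p}} {u v} → u ∣ v → p ^ u ∸ 1 ∣ p ^ v ∸ 1
  [p^u∸1]∣[p^v∸1] p {u} {v} (divides k v≡k*u) =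
    subst (p ^ u ∸ 1 ∣_) (cong (_∸ 1) (sym pᵛ≡[1+m]ᵏ)) (m∣[1+m]^k∸1 (p ^ u ∸ 1) k)
    where
    pᵛ≡[1+m]ᵏ : p ^ v ≡ suc (p ^ u ∸ 1) ^ k
    pᵛ≡[1+m]ᵏ = begin
      p ^ v                  ≡⟨ cong (p ^_) (trans v≡k*u (ℕₚ.*-comm k u)) ⟩
      p ^ (u * k)            ≡⟨ ℕₚ.^-*-assoc p u k ⟨
      (p ^ u) ^ k            ≡⟨ cong (_^ k) (ℕₚ.suc-pred (p ^ u) {{ℕₚ.m^n≢0 p u}}) ⟨
      suc (p ^ u ∸ 1) ^ k    ∎

  [m+n%o]%o≡[m+n]%o : ∀ m n o .{{_ : NonZero o}} → (m + n % o) % o ≡ (m + n) % o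
  [m+n%o]%o≡[m+n]%o m n o = begin
    (m + n % o) % o              ≡⟨ %-distribˡ-+ m (n % o) o ⟩
    (m % o + n % o % o) % o      ≡⟨ cong (λ r → (m % o + r) % o) (m%n%n≡m%n n o) ⟩
    (m % o + n % o) % o          ≡⟨ %-distribˡ-+ m n o ⟨
    (m + n) % o                  ∎

  div≡/ : ∀ a b .{{_ : NonZero b}} → div a b ≡ a / b
  div≡/ a (suc b) = refl

  div[d*[t*m]]≡d*t : ∀ d t m .{{_ : NonZero m}} → div (d * (t * m)) m ≡ d * t
  div[d*[t*m]]≡d*t d t m = begin
    div (d * (t * m)) m    ≡⟨ div≡/ (d * (t * m)) m ⟩
    d * (t * m) / m        ≡⟨ cong (_/ m) (ℕₚ.*-assoc d t m) ⟨
    d * t * m / m          ≡⟨ m*n/n≡m (d * t) m ⟩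
    d * t                  ∎

  n≡m*m*t : ∀ {m n t} .{{_ : NonZero m}} → m ∣ n → div n m ≡ t * m → n ≡ m * m * t
  n≡m*m*t {m} {n} {t} m∣n n/m≡t*m = begin
    n              ≡⟨ m/n*n≡m m∣n ⟨
    n / m * m      ≡⟨ cong (_* m) (trans (sym (div≡/ n m)) n/m≡t*m) ⟩
    t * m * m      ≡⟨ ℕₚ.*-assoc t m m ⟩
    t * (m * m)    ≡⟨ ℕₚ.*-comm t (m * m) ⟩
    m * m * t      ∎

  ∈-divisors⇒≤ : ∀ {m d} → d ∈ divisors m → d ≤ m
  ∈-divisors⇒≤ {m} d∈ with ∈-map⁻ suc (proj₁ (∈-filter⁻ (_∣? m) {xs = map suc (upTo m)} d∈))
  ... | i , i∈ , refl = ∈-upTo⁻ i∈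

open Arithmetic

sum-reindex : ∀ {c ℓ} (M : CommutativeMonoid c ℓ) {A : Set} {n} (enum : Fin n ↔ A)
              (h : A → CommutativeMonoid.Carrier M) (f : A ↔ A) →
              let open CommutativeMonoid M using (_≈_); open Sum M using (sum) in
              sum (h ∘ Inverse.to enum) ≈ sum (h ∘ Inverse.to f ∘ Inverse.to enum)
sum-reindex M enum h f = M.trans (sum-permute (h ∘ to enum) (↔-trans enum (↔-trans f (↔-sym enum))))
                                 (M.reflexive (sum-cong-≗ (cong h ∘ strictlyInverseˡ enum ∘ to f ∘ to enum)))
  where
  module M = CommutativeMonoid M
  open Sum M using (sum-permute; sum-cong-≗)
  open Inverse

module Frobenius {a ℓ} (R : CommutativeSemiring a ℓ) where

  open CommutativeSemiring R hiding (refl) renaming (sym to ≈-sym; trans to ≈-trans)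
  open import Algebra.Properties.Semiring.Exp semiring using (_^_; ^-assocʳ; ^-congˡ)
  open import Algebra.Properties.Semiring.Mult semiring using (_×_; ×-homo-1; ×-congʳ; ×-assoc-*; ×1-homo-*)
  open import Algebra.Properties.Monoid.Sum +-monoid using (sum; sum-init-last; sum-cong-≋; sum-replicate-zero)
  import Algebra.Properties.CommutativeSemiring.Binomial R as Binomial
  open import Data.Nat.Combinatorics using (_C_; nCn≡1)
  open import Relation.Binary.Reasoning.Setoid setoid

  ×-vanishes : ∀ {p} → p × 1# ≈ 0# → ∀ {n} → p ∣ n → ∀ x → n × x ≈ 0#
  ×-vanishes {p} p×1≈0 (divides r refl) x = begin
    (r ℕ.* p) × x                ≈⟨ ×-congʳ (r ℕ.* p) (*-identityˡ x) ⟨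
    (r ℕ.* p) × (1# * x)         ≈⟨ ×-assoc-* (r ℕ.* p) 1# x ⟨
    ((r ℕ.* p) × 1#) * x         ≈⟨ *-congʳ (×1-homo-* r p) ⟩
    ((r × 1#) * (p × 1#)) * x    ≈⟨ *-congʳ (*-congˡ p×1≈0) ⟩
    ((r × 1#) * 0#) * x          ≈⟨ *-congʳ (zeroʳ _) ⟩
    0# * x                       ≈⟨ zeroˡ x ⟩
    0#                           ∎

  ^p-distrib-+ : ∀ {p} → Prime p → p × 1# ≈ 0# → ∀ x y → (x + y) ^ p ≈ x ^ p + y ^ p
  ^p-distrib-+ {zero}  p-prime _ = ⊥-elim (ℕ.≢-nonZero⁻¹ 0 {{prime⇒nonZero p-prime}} refl)
  ^p-distrib-+ {suc q} p-prime p×1≈0 x y = begin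
    (x + y) ^ suc q                                           ≈⟨ Binomial.theorem (suc q) x y ⟩
    t Fin.zero + sum (t ∘ Fin.suc)                            ≈⟨ +-congˡ (sum-init-last (t ∘ Fin.suc)) ⟩
    t Fin.zero + (sum (t ∘ Fin.suc ∘ inject₁) + t (Fin.suc (fromℕ q)))
                                                              ≈⟨ +-cong first (+-cong (sum-cong-≋ middle) last) ⟩
    y ^ suc q + (sum {q} (λ _ → 0#) + x ^ suc q)              ≈⟨ +-congˡ (+-congʳ (sum-replicate-zero q)) ⟩
    y ^ suc q + (0# + x ^ suc q)                              ≈⟨ +-congˡ (+-identityˡ _) ⟩
    y ^ suc q + x ^ suc q                                     ≈⟨ +-comm _ _ ⟩
    x ^ suc q + y ^ suc q                                     ∎
    where
    t : Fin (suc (suc q)) → Carrier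
    t = Binomial.binomialTerm x y (suc q)

    first : t Fin.zero ≈ y ^ suc q
    first = ≈-trans (×-homo-1 _) (*-identityˡ _)

    middle : ∀ j → t (Fin.suc (inject₁ j)) ≈ 0#
    middle j = ×-vanishes p×1≈0 (prime∣C p-prime z<s (s<s (Finₚ.inject₁ℕ< j))) _

    last : t (Fin.suc (fromℕ q)) ≈ x ^ suc q
    last = begin
      t (Fin.suc (fromℕ q))
        ≡⟨ cong (λ k → (suc q C suc k) × (x ^ suc k * y ^ (q ∸ k))) (Finₚ.toℕ-fromℕ q) ⟩
      (suc q C suc q) × (x ^ suc q * y ^ (q ∸ q))
        ≡⟨ cong₂ (λ c k → c × (x ^ suc q * y ^ k)) (nCn≡1 (suc q)) (ℕₚ.n∸n≡0 q) ⟩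
      1 × (x ^ suc q * 1#)
        ≈⟨ ≈-trans (×-homo-1 _) (*-identityʳ _) ⟩
      x ^ suc q ∎

  ^[p^k]-distrib-+ : ∀ {p} → Prime p → p × 1# ≈ 0# → ∀ k x y →
                     (x + y) ^ (p ℕ.^ k) ≈ x ^ (p ℕ.^ k) + y ^ (p ℕ.^ k)
  ^[p^k]-distrib-+ p-prime p×1≈0 zero x y =
    ≈-trans (*-identityʳ _) (+-cong (≈-sym (*-identityʳ x)) (≈-sym (*-identityʳ y)))
  ^[p^k]-distrib-+ {p} p-prime p×1≈0 (suc k) x y = begin
    (x + y) ^ (p ℕ.* p ℕ.^ k)                   ≈⟨ ^-assocʳ (x + y) p (p ℕ.^ k) ⟨
    ((x + y) ^ p) ^ (p ℕ.^ k)                   ≈⟨ ^-congˡ (p ℕ.^ k) (^p-distrib-+ p-prime p×1≈0 x y) ⟩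
    (x ^ p + y ^ p) ^ (p ℕ.^ k)                 ≈⟨ ^[p^k]-distrib-+ p-prime p×1≈0 k (x ^ p) (y ^ p) ⟩
    (x ^ p) ^ (p ℕ.^ k) + (y ^ p) ^ (p ℕ.^ k)
                                                ≈⟨ +-cong (^-assocʳ x p (p ℕ.^ k)) (^-assocʳ y p (p ℕ.^ k)) ⟩
    x ^ (p ℕ.* p ℕ.^ k) + y ^ (p ℕ.* p ℕ.^ k)   ∎

module FiniteFieldProperties {q} (F : FiniteField q) where

  open FiniteField F public

  commutativeRing : CommutativeRing 0ℓ 0ℓ
  commutativeRing = record { isCommutativeRing = isCommutativeRing }

  open CommutativeRing commutativeRing public
    using ( +-assoc; +-comm; +-identityˡ; +-identityʳ; -‿inverseˡ; -‿inverseʳ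
          ; *-assoc; *-comm; *-identityˡ; *-identityʳ; zeroˡ; zeroʳ; distribˡ; distribʳ
          ; semiring; commutativeSemiring; +-commutativeMonoid; *-commutativeMonoid; +-group
          ; _-_; ring; +-abelianGroup; +-commutativeSemigroup; *-commutativeSemigroup)
  open import Algebra.Properties.Semiring.Exp semiring public using (_^_; ^-assocʳ)
  open import Algebra.Properties.CommutativeSemiring.Exp commutativeSemiring public using (^-distrib-*)
  open import Algebra.Properties.Semiring.Mult semiring public using (_×_; ×1-homo-*)
  open import Algebra.Properties.Group +-group using (identityˡ-unique)
  open ≡-Reasoning

  private
    module ∑ = Sum +-commutativeMonoid
    module ∏ = Sum *-commutativeMonoid
    element : Fin q → Carrier
    element = Inverse.to card

  _≟_ : DecidableEquality Carrier
  _≟_ = via-injection (↔⇒↣ (↔-sym card)) Finₚ._≟_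

  private
    inverse-cancels : ∀ {a b} → b * a ≡ 1# → ∀ x → b * (a * x) ≡ x
    inverse-cancels {a} {b} ba≡1 x = begin
      b * (a * x)  ≡⟨ *-assoc b a x ⟨
      (b * a) * x  ≡⟨ cong (_* x) ba≡1 ⟩
      1# * x       ≡⟨ *-identityˡ x ⟩
      x            ∎

  *-↔ : ∀ {a} → a ≢ 0# → Carrier ↔ Carrier
  *-↔ {a} a≢0 =
    mk↔ₛ′ (a *_) (a⁻¹ *_) (inverse-cancels aa⁻¹≡1) (inverse-cancels (trans (*-comm a⁻¹ a) aa⁻¹≡1))
    where
    a⁻¹ : Carrier
    a⁻¹ = proj₁ (inverse a a≢0)
    aa⁻¹≡1 : a * a⁻¹ ≡ 1#
    aa⁻¹≡1 = proj₂ (inverse a a≢0)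

  *-cancelˡ : ∀ {a b c} → a ≢ 0# → a * b ≡ a * c → b ≡ c
  *-cancelˡ {a} {b} {c} a≢0 ab≡ac =
    trans (sym (strictlyInverseʳ b)) (trans (cong from ab≡ac) (strictlyInverseʳ c))
    where open Inverse (*-↔ a≢0)

  *-cancelʳ : ∀ {a b c} → c ≢ 0# → a * c ≡ b * c → a ≡ b
  *-cancelʳ {a} {b} {c} c≢0 ac≡bc = *-cancelˡ c≢0 (trans (*-comm c a) (trans ac≡bc (*-comm b c)))

  x*y≡0⇒x≡0∨y≡0 : ∀ {x y} → x * y ≡ 0# → x ≡ 0# ⊎ y ≡ 0#
  x*y≡0⇒x≡0∨y≡0 {x} xy≡0 with x ≟ 0#
  ... | yes x≡0 = inj₁ x≡0
  ... | no x≢0  = inj₂ (*-cancelˡ x≢0 (trans xy≡0 (sym (zeroʳ x))))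

  *-≢0 : ∀ {x y} → x ≢ 0# → y ≢ 0# → x * y ≢ 0#
  *-≢0 x≢0 y≢0 xy≡0 = [ x≢0 , y≢0 ] (x*y≡0⇒x≡0∨y≡0 xy≡0)

  1≢0 : 1# ≢ 0#
  1≢0 = 0≢1 ∘ sym

  ^-≢0 : ∀ {x} → x ≢ 0# → ∀ k → x ^ k ≢ 0#
  ^-≢0 x≢0 zero    = 1≢0
  ^-≢0 x≢0 (suc k) = *-≢0 x≢0 (^-≢0 x≢0 k)

  ^-≡0 : ∀ {x} k → x ^ k ≡ 0# → x ≡ 0#
  ^-≡0 {x} k xᵏ≡0 with x ≟ 0#
  ... | yes x≡0 = x≡0
  ... | no x≢0  = ⊥-elim (^-≢0 x≢0 k xᵏ≡0)

  +-↔ : Carrier → Carrier ↔ Carrier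
  +-↔ a = mk↔ₛ′ (a +_) (- a +_) (cancels a (- a) (-‿inverseʳ a)) (cancels (- a) a (-‿inverseˡ a))
    where
    cancels : ∀ x y → x + y ≡ 0# → ∀ z → x + (y + z) ≡ z
    cancels x y x+y≡0 z = trans (sym (+-assoc x y z)) (trans (cong (_+ z) x+y≡0) (+-identityˡ z))

  q×1≡0 : q × 1# ≡ 0#
  q×1≡0 = identityˡ-unique (q × 1#) (∑.sum element) (sym (begin
    ∑.sum element                         ≡⟨ sum-reindex +-commutativeMonoid card id (+-↔ 1#) ⟩
    ∑.sum (λ i → 1# + element i)          ≡⟨ ∑.∑-distrib-+ {q} (λ _ → 1#) element ⟩
    ∑.sum {q} (λ _ → 1#) + ∑.sum element  ≡⟨ cong (_+ ∑.sum element) (∑.sum-replicate q) ⟩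
    q × 1# + ∑.sum element                ∎))

  private
    orOne : Carrier → Carrier
    orOne x with x ≟ 0#
    ... | yes _ = 1#
    ... | no _  = x

    orOne-0 : orOne 0# ≡ 1#
    orOne-0 with 0# ≟ 0#
    ... | yes _   = refl
    ... | no 0≢0  = ⊥-elim (0≢0 refl)

    orOne-≢0 : ∀ {x} → x ≢ 0# → orOne x ≡ x
    orOne-≢0 {x} x≢0 with x ≟ 0#
    ... | yes x≡0 = ⊥-elim (x≢0 x≡0)
    ... | no _    = refl

  ∏-≢0 : ∀ {n} (g : Fin n → Carrier) → (∀ i → g i ≢ 0#) → ∏.sum g ≢ 0#
  ∏-≢0 {zero}  g _   = 1≢0
  ∏-≢0 {suc n} g g≢0 = *-≢0 (g≢0 Fin.zero) (∏-≢0 (g ∘ Fin.suc) (g≢0 ∘ Fin.suc))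

  -- Multiplication by a ≠ 0 permutes the nonzero elements, so a^(n-1) · ∏ x = ∏ x over them;
  -- orOne (0 ↦ 1) lets that product be written over all of F and reindexed by x ↦ a x.
  x^n≡x : ∀ {n} → Fin n ↔ Carrier → ∀ a → a ^ n ≡ a
  x^n≡x {zero} enum a with Inverse.from enum a
  ... | ()
  x^n≡x {suc n} enum a with a ≟ 0#
  ... | yes refl = zeroˡ (0# ^ n)
  ... | no a≢0   = trans (cong (a *_) aⁿ≡1) (*-identityʳ a)
    where
    open Inverse enum using (to; from; strictlyInverseˡ; strictlyInverseʳ)
    z : Fin (suc n)
    z = from 0#

    nonzero : Fin n → Carrier
    nonzero = removeAt to z

    nonzero-≢0 : ∀ j → nonzero j ≢ 0#
    nonzero-≢0 j eq = punchInᵢ≢i z j (trans (sym (strictlyInverseʳ _)) (cong from eq))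

    ∏-drop-0 : ∀ g → g 0# ≡ 1# → ∏.sum (g ∘ to) ≡ ∏.sum (g ∘ nonzero)
    ∏-drop-0 g g0≡1 = begin
      ∏.sum (g ∘ to)                    ≡⟨ ∏.sum-remove {i = z} (g ∘ to) ⟩
      g (to z) * ∏.sum (g ∘ nonzero)    ≡⟨ cong (λ y → g y * ∏.sum (g ∘ nonzero)) (strictlyInverseˡ 0#) ⟩
      g 0# * ∏.sum (g ∘ nonzero)        ≡⟨ cong (_* ∏.sum (g ∘ nonzero)) g0≡1 ⟩
      1# * ∏.sum (g ∘ nonzero)          ≡⟨ *-identityˡ _ ⟩
      ∏.sum (g ∘ nonzero)               ∎

    P : Carrier
    P = ∏.sum nonzero

    aⁿP≡P : a ^ n * P ≡ 1# * P
    aⁿP≡P = begin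
      a ^ n * P
        ≡⟨ cong (_* P) (∏.sum-replicate n) ⟨
      ∏.sum {n} (λ _ → a) * P
        ≡⟨ ∏.∑-distrib-+ (λ _ → a) nonzero ⟨
      ∏.sum (λ j → a * nonzero j)
        ≡⟨ ∏.sum-cong-≗ (λ j → orOne-≢0 (*-≢0 a≢0 (nonzero-≢0 j))) ⟨
      ∏.sum (orOne ∘ (a *_) ∘ nonzero)
        ≡⟨ ∏-drop-0 (orOne ∘ (a *_)) (trans (cong orOne (zeroʳ a)) orOne-0) ⟨
      ∏.sum (orOne ∘ (a *_) ∘ to)
        ≡⟨ sum-reindex *-commutativeMonoid enum orOne (*-↔ a≢0) ⟨
      ∏.sum (orOne ∘ to)
        ≡⟨ ∏-drop-0 orOne orOne-0 ⟩
      ∏.sum (orOne ∘ nonzero)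
        ≡⟨ ∏.sum-cong-≗ (λ j → orOne-≢0 (nonzero-≢0 j)) ⟩
      P
        ≡⟨ *-identityˡ P ⟨
      1# * P ∎

    aⁿ≡1 : a ^ n ≡ 1#
    aⁿ≡1 = *-cancelʳ (∏-≢0 nonzero nonzero-≢0) aⁿP≡P

  fermat : ∀ a → a ^ q ≡ a
  fermat = x^n≡x card

  ×1-homo-^ : ∀ p v → (p ℕ.^ v) × 1# ≡ (p × 1#) ^ v
  ×1-homo-^ p zero    = +-identityʳ 1#
  ×1-homo-^ p (suc v) = trans (×1-homo-* p (p ℕ.^ v)) (cong ((p × 1#) *_) (×1-homo-^ p v))

  q≡p^v⇒p×1≡0 : ∀ {p v} → q ≡ p ℕ.^ v → p × 1# ≡ 0#
  q≡p^v⇒p×1≡0 {p} {v} q≡pᵛ = ^-≡0 v (begin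
    (p × 1#) ^ v       ≡⟨ ×1-homo-^ p v ⟨
    (p ℕ.^ v) × 1#     ≡⟨ cong (_× 1#) q≡pᵛ ⟨
    q × 1#             ≡⟨ q×1≡0 ⟩
    0#                 ∎)

  ^[p^k]-distrib-+ : ∀ {p v} → Prime p → q ≡ p ℕ.^ v →
                     ∀ k a b → (a + b) ^ (p ℕ.^ k) ≡ a ^ (p ℕ.^ k) + b ^ (p ℕ.^ k)
  ^[p^k]-distrib-+ {p} {v} p-prime q≡pᵛ =
    Frobenius.^[p^k]-distrib-+ commutativeSemiring p-prime (q≡p^v⇒p×1≡0 {p} {v} q≡pᵛ)

  1^k≡1 : ∀ k → 1# ^ k ≡ 1#
  1^k≡1 zero    = refl
  1^k≡1 (suc k) = trans (*-identityˡ (1# ^ k)) (1^k≡1 k)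

idᴱ : ∀ {q} (F : FiniteField q) → Embedding F F
idᴱ F = record { ι = id ; ι-+ = λ _ _ → refl ; ι-* = λ _ _ → refl ; ι-0 = refl ; ι-1 = refl }

module Eigenvectors {q} (F : FiniteField q) (σ : FiniteField.Carrier F → FiniteField.Carrier F)
  (σ-+ : ∀ a b → σ (FiniteField._+_ F a b) ≡ FiniteField._+_ F (σ a) (σ b))
  (σ-* : ∀ a b → σ (FiniteField._*_ F a b) ≡ FiniteField._*_ F (σ a) (σ b)) where

  open FiniteFieldProperties F
  open import Algebra.Properties.Group +-group using (identityˡ-unique; inverseˡ-unique; x∙y⁻¹≈ε⇒x≈y)
  open import Algebra.Properties.AbelianGroup +-abelianGroup using (⁻¹-∙-comm)
  open import Algebra.Properties.Ring ring using (-‿distribˡ-*)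
  open import Algebra.Properties.CommutativeSemigroup +-commutativeSemigroup using (interchange)
  open import Algebra.Properties.CommutativeSemigroup *-commutativeSemigroup using (x∙yz≈y∙xz)
  open ≡-Reasoning

  Fixed : Carrier → Set
  Fixed a = σ a ≡ a

  σ-0 : σ 0# ≡ 0#
  σ-0 = identityˡ-unique (σ 0#) (σ 0#) (sym (trans (cong σ (sym (+-identityˡ 0#))) (σ-+ 0# 0#)))

  σ-‿ : ∀ a → σ (- a) ≡ - σ a
  σ-‿ a = inverseˡ-unique (σ (- a)) (σ a) (trans (sym (σ-+ (- a) a)) (trans (cong σ (-‿inverseˡ a)) σ-0))

  a*0-σ0≡0 : ∀ a → a * 0# - σ 0# ≡ 0#
  a*0-σ0≡0 a = trans (cong₂ _-_ (zeroʳ a) σ-0) (-‿inverseʳ 0#)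

  record IsEigenvector (v a : Carrier) : Set where
    field
      nonzero      : v ≢ 0#
      σ-scales     : σ v ≡ a * v
      value-fixed  : Fixed a

  open IsEigenvector

  module _ {I : Set} (x μ : I → Carrier) where

    Coefficients : List I → Set
    Coefficients ds = Vec Carrier (length (map x ds))

    comb : ∀ ds → Coefficients ds → Carrier
    comb ds = linComb (idᴱ F) (map x ds)

    twist : Carrier → ∀ ds → Coefficients ds → Coefficients ds
    twist μ₀ []       []       = []
    twist μ₀ (d ∷ ds) (c ∷ cs) = (μ₀ - μ d) * c ∷ twist μ₀ ds cs

    comb-zero : ∀ ds {cs} → VecAll.All (_≡ 0#) cs → comb ds cs ≡ 0#
    comb-zero []       VecAll.[]            = refl
    comb-zero (d ∷ ds) {c ∷ cs} (c≡0 VecAll.∷ cs≡0) = begin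
      c * x d + comb ds cs  ≡⟨ cong₂ (λ a b → a * x d + b) c≡0 (comb-zero ds cs≡0) ⟩
      0# * x d + 0#         ≡⟨ trans (+-identityʳ _) (zeroˡ (x d)) ⟩
      0#                    ∎

    Eigen : I → Set
    Eigen d = IsEigenvector (x d) (μ d)

    comb-twist : ∀ μ₀ ds cs → All Eigen ds → VecAll.All Fixed cs →
                 comb ds (twist μ₀ ds cs) ≡ μ₀ * comb ds cs - σ (comb ds cs)
    comb-twist μ₀ []       []       []            VecAll.[] =
      sym (a*0-σ0≡0 μ₀)
    comb-twist μ₀ (d ∷ ds) (c ∷ cs) (eig-d ∷ eig) (σc≡c VecAll.∷ fixed) = begin
      ((μ₀ - μ d) * c) * x d + comb ds (twist μ₀ ds cs)
        ≡⟨ cong₂ _+_ term (comb-twist μ₀ ds cs eig fixed) ⟩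
      (μ₀ * (c * x d) - σ (c * x d)) + (μ₀ * L - σ L)
        ≡⟨ interchange _ _ _ _ ⟩
      (μ₀ * (c * x d) + μ₀ * L) + (- σ (c * x d) + - σ L)
        ≡⟨ cong₂ _+_ (sym (distribˡ μ₀ _ _)) (trans (⁻¹-∙-comm _ _) (cong -_ (sym (σ-+ _ _)))) ⟩
      μ₀ * (c * x d + L) - σ (c * x d + L) ∎
      where
      L : Carrier
      L = comb ds cs
      σ[cx]≡μcx : σ (c * x d) ≡ μ d * (c * x d)
      σ[cx]≡μcx = begin
        σ (c * x d)        ≡⟨ σ-* c (x d) ⟩
        σ c * σ (x d)      ≡⟨ cong₂ _*_ σc≡c (σ-scales eig-d) ⟩
        c * (μ d * x d)    ≡⟨ x∙yz≈y∙xz c (μ d) (x d) ⟩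
        μ d * (c * x d)    ∎
      term : ((μ₀ - μ d) * c) * x d ≡ μ₀ * (c * x d) - σ (c * x d)
      term = begin
        ((μ₀ - μ d) * c) * x d               ≡⟨ *-assoc _ c (x d) ⟩
        (μ₀ - μ d) * (c * x d)               ≡⟨ distribʳ (c * x d) μ₀ (- μ d) ⟩
        μ₀ * (c * x d) + - μ d * (c * x d)   ≡⟨ cong (μ₀ * (c * x d) +_) (-‿distribˡ-* (μ d) (c * x d)) ⟨
        μ₀ * (c * x d) - μ d * (c * x d)     ≡⟨ cong (λ y → μ₀ * (c * x d) - y) σ[cx]≡μcx ⟨
        μ₀ * (c * x d) - σ (c * x d)         ∎

    twist-fixed : ∀ {μ₀} → Fixed μ₀ → ∀ ds {cs} → All Eigen ds → VecAll.All Fixed cs →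
                  VecAll.All Fixed (twist μ₀ ds cs)
    twist-fixed σμ₀≡μ₀ []       {[]} []       VecAll.[]              = VecAll.[]
    twist-fixed {μ₀} σμ₀≡μ₀ (d ∷ ds) {c ∷ _} (eig-d ∷ eig) (σc≡c VecAll.∷ fixed) =
      σ-twisted VecAll.∷ twist-fixed σμ₀≡μ₀ ds eig fixed
      where
      σ-twisted : σ ((μ₀ - μ d) * c) ≡ (μ₀ - μ d) * c
      σ-twisted = begin
        σ ((μ₀ - μ d) * c)             ≡⟨ σ-* _ c ⟩
        σ (μ₀ - μ d) * σ c             ≡⟨ cong (_* σ c) (σ-+ μ₀ (- μ d)) ⟩
        (σ μ₀ + σ (- μ d)) * σ c       ≡⟨ cong (λ y → (σ μ₀ + y) * σ c) (σ-‿ (μ d)) ⟩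
        (σ μ₀ - σ (μ d)) * σ c
          ≡⟨ cong₂ (λ y z → (y - z) * σ c) σμ₀≡μ₀ (value-fixed eig-d) ⟩
        (μ₀ - μ d) * σ c               ≡⟨ cong ((μ₀ - μ d) *_) σc≡c ⟩
        (μ₀ - μ d) * c                 ∎

    twist-vanishes : ∀ {μ₀} ds {cs} → All (λ d → μ₀ ≢ μ d) ds →
                     VecAll.All (_≡ 0#) (twist μ₀ ds cs) → VecAll.All (_≡ 0#) cs
    twist-vanishes []       {[]} []        VecAll.[]               = VecAll.[]
    twist-vanishes {μ₀} (d ∷ ds) {c ∷ _} (μ₀≢μd ∷ distinct) (twisted≡0 VecAll.∷ rest)
      with x*y≡0⇒x≡0∨y≡0 twisted≡0
    ... | inj₁ μ₀-μd≡0 = ⊥-elim (μ₀≢μd (x∙y⁻¹≈ε⇒x≈y μ₀ (μ d) μ₀-μd≡0))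
    ... | inj₂ c≡0     = c≡0 VecAll.∷ twist-vanishes ds distinct rest

    eigenvectors-independent : ∀ ds → All Eigen ds → AllPairs (λ d e → μ d ≢ μ e) ds →
                               (cs : Coefficients ds) → VecAll.All Fixed cs →
                               comb ds cs ≡ 0# → VecAll.All (_≡ 0#) cs
    eigenvectors-independent []       _             _                []       _      _ = VecAll.[]
    eigenvectors-independent (d ∷ ds) eigs@(eig-d ∷ eig-ds) (μd≢ ∷ distinct) (c ∷ cs) all-fixed@(_ VecAll.∷ fixed)
                             comb≡0 =
      c≡0 VecAll.∷ cs≡0
      where
      T : Carrier
      T = comb ds (twist (μ d) ds cs)

      head≡0 : ((μ d - μ d) * c) * x d ≡ 0#
      head≡0 = begin
        ((μ d - μ d) * c) * x d   ≡⟨ cong (λ y → (y * c) * x d) (-‿inverseʳ (μ d)) ⟩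
        (0# * c) * x d            ≡⟨ cong (_* x d) (zeroˡ c) ⟩
        0# * x d                  ≡⟨ zeroˡ (x d) ⟩
        0#                        ∎

      T≡0 : T ≡ 0#
      T≡0 = begin
        T                                      ≡⟨ +-identityˡ T ⟨
        0# + T                                 ≡⟨ cong (_+ T) head≡0 ⟨
        ((μ d - μ d) * c) * x d + T            ≡⟨ comb-twist (μ d) (d ∷ ds) (c ∷ cs) eigs all-fixed ⟩
        μ d * comb (d ∷ ds) (c ∷ cs) - σ (comb (d ∷ ds) (c ∷ cs))
                                               ≡⟨ cong (λ y → μ d * y - σ y) comb≡0 ⟩
        μ d * 0# - σ 0#                        ≡⟨ a*0-σ0≡0 (μ d) ⟩
        0#                                     ∎

      cs≡0 : VecAll.All (_≡ 0#) cs
      cs≡0 = twist-vanishes ds μd≢ (eigenvectors-independent ds eig-ds distinct (twist (μ d) ds cs)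
                                      (twist-fixed (value-fixed eig-d) ds eig-ds fixed) T≡0)

      c*xd≡0 : c * x d ≡ 0#
      c*xd≡0 = begin
        c * x d                  ≡⟨ +-identityʳ (c * x d) ⟨
        c * x d + 0#             ≡⟨ cong (c * x d +_) (comb-zero ds cs≡0) ⟨
        c * x d + comb ds cs     ≡⟨ comb≡0 ⟩
        0#                       ∎

      c≡0 : c ≡ 0#
      c≡0 with x*y≡0⇒x≡0∨y≡0 c*xd≡0
      ... | inj₁ c≡0  = c≡0
      ... | inj₂ xd≡0 = ⊥-elim (nonzero eig-d xd≡0)

module EmbeddingProperties {qK qF} {K : FiniteField qK} {F : FiniteField qF} (e : Embedding K F) where

  private module K = FiniteFieldProperties K
  open FiniteFieldProperties F
  open Embedding e

  ι-^ : ∀ c k → ι (c K.^ k) ≡ ι c ^ k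
  ι-^ c zero    = ι-1
  ι-^ c (suc k) = trans (ι-* c (c K.^ k)) (cong (ι c *_) (ι-^ c k))

  ι≡0⇒≡0 : ∀ {c} → ι c ≡ 0# → c ≡ K.0#
  ι≡0⇒≡0 {c} ιc≡0 with c K.≟ K.0#
  ... | yes c≡0 = c≡0
  ... | no c≢0  = ⊥-elim (0≢1 (begin
    0#                 ≡⟨ zeroˡ (ι c⁻¹) ⟨
    0# * ι c⁻¹         ≡⟨ cong (_* ι c⁻¹) ιc≡0 ⟨
    ι c * ι c⁻¹        ≡⟨ ι-* c c⁻¹ ⟨
    ι (c K.* c⁻¹)      ≡⟨ cong ι (proj₂ (K.inverse c c≢0)) ⟩
    ι K.1#             ≡⟨ ι-1 ⟩
    1#                 ∎))
    where
    open ≡-Reasoning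
    c⁻¹ : K.Carrier
    c⁻¹ = proj₁ (K.inverse c c≢0)

  linComb-ι : ∀ xs cs → linComb e xs cs ≡ linComb (idᴱ F) xs (Vec.map ι cs)
  linComb-ι []       []       = refl
  linComb-ι (x ∷ xs) (c ∷ cs) = cong (ι c * x +_) (linComb-ι xs cs)

toℕ-addMod : ∀ {n} .{{_ : NonZero n}} (a b : Fin n) → toℕ (addMod a b) ≡ (toℕ a ℕ.+ toℕ b) % n
toℕ-addMod {suc n} a b = Finₚ.toℕ-fromℕ< _

module GroupIsoProperties {q} {F : FiniteField q} {n} (G : GroupIso F n) where

  open FiniteFieldProperties F
  open GroupIso G
  open ≡-Reasoning

  1ᵘ : Units
  1ᵘ = 1# , 1≢0

  instance
    n≢0 : NonZero n
    n≢0 = Finₚ.nonZeroIndex (φ 1ᵘ)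

  _^ᵘ_ : Units → ℕ → Units
  a ^ᵘ k = proj₁ a ^ k , ^-≢0 (proj₂ a) k

  φ-injectiveℕ : ∀ {a b} → toℕ (φ a) ≡ toℕ (φ b) → proj₁ a ≡ proj₁ b
  φ-injectiveℕ {a} {b} = φ-injective a b ∘ Finₚ.toℕ-injective

  φ-surjectiveℕ : ∀ {k} → k < n → Σ Units (λ a → toℕ (φ a) ≡ k)
  φ-surjectiveℕ k<n with φ-surjective (Fin.fromℕ< k<n)
  ... | a , φa≡k = a , trans (cong toℕ φa≡k) (Finₚ.toℕ-fromℕ< k<n)

  toℕ-φ-1ᵘ : toℕ (φ 1ᵘ) ≡ 0
  toℕ-φ-1ᵘ with φ-surjectiveℕ (ℕ.>-nonZero⁻¹ n)
  ... | z , φz≡0 = begin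
    toℕ (φ 1ᵘ)                        ≡⟨ m<n⇒m%n≡m (Finₚ.toℕ<n (φ 1ᵘ)) ⟨
    toℕ (φ 1ᵘ) % n                    ≡⟨ cong (_% n) (ℕₚ.+-identityʳ _) ⟨
    (toℕ (φ 1ᵘ) ℕ.+ 0) % n            ≡⟨ cong (λ k → (toℕ (φ 1ᵘ) ℕ.+ k) % n) φz≡0 ⟨
    (toℕ (φ 1ᵘ) ℕ.+ toℕ (φ z)) % n    ≡⟨ toℕ-addMod (φ 1ᵘ) (φ z) ⟨
    toℕ (addMod (φ 1ᵘ) (φ z))         ≡⟨ cong toℕ (φ-hom 1ᵘ z 1z≢0) ⟨
    toℕ (φ (1# * proj₁ z , 1z≢0))     ≡⟨ cong toℕ (φ-cong _ z (*-identityˡ (proj₁ z))) ⟩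
    toℕ (φ z)                         ≡⟨ φz≡0 ⟩
    0                                 ∎
    where
    1z≢0 : 1# * proj₁ z ≢ 0#
    1z≢0 = *-≢0 1≢0 (proj₂ z)

  toℕ-φ-^ : ∀ a k → toℕ (φ (a ^ᵘ k)) ≡ (k ℕ.* toℕ (φ a)) % n
  toℕ-φ-^ a zero    = trans (cong toℕ (φ-cong (a ^ᵘ 0) 1ᵘ refl)) (trans toℕ-φ-1ᵘ (sym (m*n%n≡0 0 n)))
  toℕ-φ-^ a (suc k) = begin
    toℕ (φ (a ^ᵘ suc k))               ≡⟨ cong toℕ (φ-hom a (a ^ᵘ k) (proj₂ (a ^ᵘ suc k))) ⟩
    toℕ (addMod (φ a) (φ (a ^ᵘ k)))    ≡⟨ toℕ-addMod (φ a) (φ (a ^ᵘ k)) ⟩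
    (s ℕ.+ toℕ (φ (a ^ᵘ k))) % n       ≡⟨ cong (λ r → (s ℕ.+ r) % n) (toℕ-φ-^ a k) ⟩
    (s ℕ.+ (k ℕ.* s) % n) % n          ≡⟨ [m+n%o]%o≡[m+n]%o s (k ℕ.* s) n ⟩
    (suc k ℕ.* s) % n                  ∎
    where
    s : ℕ
    s = toℕ (φ a)

  ^≡1-via-φ : ∀ a k → (k ℕ.* toℕ (φ a)) % n ≡ 0 → proj₁ a ^ k ≡ 1#
  ^≡1-via-φ a k ks%n≡0 =
    φ-injectiveℕ {a ^ᵘ k} {1ᵘ} (trans (toℕ-φ-^ a k) (trans ks%n≡0 (sym toℕ-φ-1ᵘ)))

  ≡^-via-φ : ∀ {a b} k → toℕ (φ b) ≡ k ℕ.* toℕ (φ a) → k ℕ.* toℕ (φ a) < n →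
             proj₁ b ≡ proj₁ a ^ k
  ≡^-via-φ {a} {b} k φb≡ks ks<n =
    φ-injectiveℕ {b} {a ^ᵘ k} (trans φb≡ks (trans (sym (m<n⇒m%n≡m ks<n)) (sym (toℕ-φ-^ a k))))

  ^-injective : ∀ a {s} .{{_ : NonZero s}} → toℕ (φ a) ≡ s →
                ∀ {i j} → i ℕ.* s < n → j ℕ.* s < n → proj₁ a ^ i ≡ proj₁ a ^ j → i ≡ j
  ^-injective a {s} φa≡s {i} {j} is<n js<n aⁱ≡aʲ = ℕₚ.*-cancelʳ-≡ i j s (begin
    i ℕ.* s                    ≡⟨ m<n⇒m%n≡m is<n ⟨
    (i ℕ.* s) % n              ≡⟨ toℕ-φ-aᵏ i ⟨
    toℕ (φ (a ^ᵘ i))           ≡⟨ cong toℕ (φ-cong (a ^ᵘ i) (a ^ᵘ j) aⁱ≡aʲ) ⟩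
    toℕ (φ (a ^ᵘ j))           ≡⟨ toℕ-φ-aᵏ j ⟩
    (j ℕ.* s) % n              ≡⟨ m<n⇒m%n≡m js<n ⟩
    j ℕ.* s                    ∎)
    where
    toℕ-φ-aᵏ : ∀ k → toℕ (φ (a ^ᵘ k)) ≡ (k ℕ.* s) % n
    toℕ-φ-aᵏ k = trans (toℕ-φ-^ a k) (cong (λ r → (k ℕ.* r) % n) φa≡s)

module PowerIndependence
  {qK qF} {K : FiniteField qK} {F : FiniteField qF} (e : Embedding K F) {n} (G : GroupIso F n) {Q}
  (Q-fixes-K : ∀ c → FiniteFieldProperties._^_ K c Q ≡ c)
  (^Q-distrib-+ : ∀ a b → FiniteFieldProperties._^_ F (FiniteField._+_ F a b) Q ≡
                          FiniteField._+_ F (FiniteFieldProperties._^_ F a Q) (FiniteFieldProperties._^_ F b Q))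
  {m t} (Q≡1+m : Q ≡ suc m) (n≡m*m*t : n ≡ m ℕ.* m ℕ.* t) (1<m : 1 < m) where

  open FiniteFieldProperties F
  open GroupIso G using (φ)
  open GroupIsoProperties G
  open EmbeddingProperties e
  open Embedding e using (ι)
  open ≡-Reasoning

  ^Q-distrib-* : ∀ a b → (a * b) ^ Q ≡ a ^ Q * b ^ Q
  ^Q-distrib-* a b = ^-distrib-* a b Q

  open Eigenvectors F (_^ Q) ^Q-distrib-+ ^Q-distrib-*

  private
    instance
      t≢0 : NonZero t
      t≢0 = ℕₚ.m*n≢0⇒n≢0 (m ℕ.* m) {{subst NonZero n≡m*m*t n≢0}}
      m≢0 : NonZero m
      m≢0 = ℕ.>-nonZero (ℕₚ.<-trans z<s 1<m)

    d<m*m⇒d*t<n : ∀ {d} → d < m ℕ.* m → d ℕ.* t < n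
    d<m*m⇒d*t<n d<m*m = subst (_ <_) (sym n≡m*m*t) (ℕₚ.*-monoˡ-< t d<m*m)

    t<n : t < n
    t<n = subst (_< n) (ℕₚ.*-identityˡ t) (d<m*m⇒d*t<n (ℕₚ.<-≤-trans 1<m (ℕₚ.m≤m*n m m)))

    βᵘ : Units
    βᵘ = proj₁ (φ-surjectiveℕ t<n)

    φβ≡t : toℕ (φ βᵘ) ≡ t
    φβ≡t = proj₂ (φ-surjectiveℕ t<n)

  β γ : Carrier
  β = proj₁ βᵘ
  γ = β ^ m

  ≡β^ : ∀ (y : Units) {d} → d < m ℕ.* m → toℕ (φ y) ≡ d ℕ.* t → proj₁ y ≡ β ^ d
  ≡β^ y {d} d<m*m φy≡dt = ≡^-via-φ d (trans φy≡dt (cong (d ℕ.*_) (sym φβ≡t)))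
                                      (subst (λ s → d ℕ.* s < n) (sym φβ≡t) (d<m*m⇒d*t<n d<m*m))

  ^-comm : ∀ x i j → (x ^ i) ^ j ≡ (x ^ j) ^ i
  ^-comm x i j = trans (^-assocʳ x i j) (trans (cong (x ^_) (ℕₚ.*-comm i j)) (sym (^-assocʳ x j i)))

  ^Q≡^m* : ∀ x → x ^ Q ≡ x ^ m * x
  ^Q≡^m* x = trans (cong (x ^_) Q≡1+m) (*-comm x (x ^ m))

  γᵐ≡1 : γ ^ m ≡ 1#
  γᵐ≡1 = trans (^-assocʳ β m m) (^≡1-via-φ βᵘ (m ℕ.* m) (begin
    (m ℕ.* m ℕ.* toℕ (φ βᵘ)) % n   ≡⟨ cong (λ s → (m ℕ.* m ℕ.* s) % n) φβ≡t ⟩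
    (m ℕ.* m ℕ.* t) % n            ≡⟨ cong (_% n) n≡m*m*t ⟨
    n % n                          ≡⟨ n%n≡0 n ⟩
    0                              ∎))

  eigenpair : ∀ d → IsEigenvector (β ^ d) (γ ^ d)
  eigenpair d = record
    { nonzero     = ^-≢0 (proj₂ βᵘ) d
    ; σ-scales    = begin
        (β ^ d) ^ Q            ≡⟨ ^Q≡^m* (β ^ d) ⟩
        (β ^ d) ^ m * β ^ d    ≡⟨ cong (_* β ^ d) (^-comm β d m) ⟩
        γ ^ d * β ^ d          ∎
    ; value-fixed = begin
        (γ ^ d) ^ Q            ≡⟨ ^Q≡^m* (γ ^ d) ⟩
        (γ ^ d) ^ m * γ ^ d    ≡⟨ cong (_* γ ^ d) (^-comm γ d m) ⟩
        (γ ^ m) ^ d * γ ^ d    ≡⟨ cong (λ y → y ^ d * γ ^ d) γᵐ≡1 ⟩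
        1# ^ d * γ ^ d         ≡⟨ cong (_* γ ^ d) (1^k≡1 d) ⟩
        1# * γ ^ d             ≡⟨ *-identityˡ (γ ^ d) ⟩
        γ ^ d                  ∎
    }

  γ-powers-distinct : ∀ {i j} → i < j → j < m → γ ^ suc i ≢ γ ^ suc j
  γ-powers-distinct {i} {j} i<j j<m γ¹⁺ⁱ≡γ¹⁺ʲ = ℕₚ.<⇒≢ i<j (ℕₚ.*-cancelˡ-≡ i j m mi≡mj)
    where
    bound : ∀ {k} → k < m → m ℕ.* k ℕ.* t < n
    bound k<m = d<m*m⇒d*t<n (ℕₚ.*-monoʳ-< m k<m)
    mi≡mj : m ℕ.* i ≡ m ℕ.* j
    mi≡mj = ^-injective βᵘ φβ≡t (bound (ℕₚ.<-trans i<j j<m)) (bound j<m) (begin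
      β ^ (m ℕ.* i)    ≡⟨ ^-assocʳ β m i ⟨
      γ ^ i            ≡⟨ *-cancelˡ (^-≢0 (proj₂ βᵘ) m) γ¹⁺ⁱ≡γ¹⁺ʲ ⟩
      γ ^ j            ≡⟨ ^-assocʳ β m j ⟩
      β ^ (m ℕ.* j)    ∎)

  filtered-powers-independent : ∀ {p} {P : Pred ℕ p} (P? : Decidable P) →
                                LinearlyIndependent e (map (β ^_) (filter P? (map suc (upTo m))))
  filtered-powers-independent P? cs comb≡0 =
    VecAll.map ι≡0⇒≡0 (VecAllₚ.map⁻ (eigenvectors-independent (β ^_) (γ ^_) ds
      (All.universal eigenpair ds) distinct (Vec.map ι cs) fixed ιcomb≡0))
    where
    ds : List ℕ
    ds = filter P? (map suc (upTo m))
    ιcomb≡0 : linComb (idᴱ F) (map (β ^_) ds) (Vec.map ι cs) ≡ 0#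
    ιcomb≡0 = trans (sym (linComb-ι (map (β ^_) ds) cs)) comb≡0
    distinct : AllPairs (λ d e → γ ^ d ≢ γ ^ e) ds
    distinct = AllPairsₚ.filter⁺ P? (AllPairsₚ.map⁺ (AllPairsₚ.applyUpTo⁺₁ id m γ-powers-distinct))
    fixed : VecAll.All Fixed (Vec.map ι cs)
    fixed = VecAllₚ.map⁺ (VecAll.universal (λ c → trans (sym (ι-^ c Q)) (cong ι (Q-fixes-K c))) cs)

-- ℕ's _*_ and _^_ are opened unqualified only from here on: above, they name the field operations.
open import Data.Nat using (ℕ; _∸_; _^_; _*_; _<_)
open import Data.Nat.Divisibility using (_∣_)
open import Data.Nat.Primality using (Prime)
open import Data.Fin using (toℕ)
open import Data.List using (map)
open import Data.List.Membership.Propositional using (_∈_)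
open import Data.Product using (proj₁)
open import Relation.Binary.PropositionalEquality using (_≡_)

proposition5 : ∀ (p u v : ℕ) → Prime p → u ∣ v →
    (K : FiniteField (p ^ u)) (F : FiniteField (p ^ v)) (e : Embedding K F) →
    let m = p ^ u ∸ 1
        n = p ^ v ∸ 1
        l = div n m
    in (G : GroupIso F n) → 1 < m → m ∣ l →
    (x : ℕ → FiniteField.Units F) →
    (∀ d → d ∈ divisors m → toℕ (GroupIso.φ G (x d)) ≡ div (d * l) m) →
    LinearlyIndependent e (map (λ d → proj₁ (x d)) (divisors m))
proposition5 p u v p-prime u∣v K F e G 1<m (divides t l≡t*m) x φ[x]≡ =
  subst (LinearlyIndependent e) (sym (map-cong-local x≡β^)) (filtered-powers-independent (_∣? m))
  where
  module F = FiniteFieldProperties F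

  m : ℕ
  m = p ^ u ∸ 1

  instance
    p≢0 : NonZero p
    p≢0 = prime⇒nonZero p-prime
    m≢0 : NonZero m
    m≢0 = ℕ.>-nonZero (ℕₚ.<-trans z<s 1<m)

  p^u≡1+m : p ^ u ≡ suc m
  p^u≡1+m = sym (ℕₚ.suc-pred (p ^ u) {{ℕₚ.m^n≢0 p u}})

  open PowerIndependence e G (FiniteFieldProperties.fermat K) (F.^[p^k]-distrib-+ {p} {v} p-prime refl u)
         p^u≡1+m (n≡m*m*t {t = t} ([p^u∸1]∣[p^v∸1] p u∣v) l≡t*m) 1<m

  x≡β^ : All (λ d → proj₁ (x d) ≡ β F.^ d) (divisors m)
  x≡β^ = All.tabulate λ {d} d∈ →
    ≡β^ (x d) (ℕₚ.≤-<-trans (∈-divisors⇒≤ d∈) (ℕₚ.m<m*n m m 1<m))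
              (trans (φ[x]≡ d d∈) (trans (cong (λ l → div (d * l) m) l≡t*m) (div[d*[t*m]]≡d*t d t m)))
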